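{- Let $H\in M_N(\pm1)$ be an Hadamard matrix of order $N\ge 4$, and let $S_1,\dots,S_N$ be the sums of the entries on its rows. (1) The numbers $S_1,\dots,S_N$ are all even, and they are all congruent to each other modulo $4$. (2) If $S_1,\dots,S_N$ are all $\equiv 0 \pmod 4$, then the number of indices $i$ with $S_i\equiv 4\pmod 8$ is odd when $N\equiv 4\pmod 8$, and even when $N\equiv 0\pmod 8$.
   Context: An Hadamard matrix is a square matrix $H\in M_N(\pm1)$ whose rows are pairwise orthogonal in $\mathbb{R}^N$. -}

module Defs where

open import Data.Nat using (ℕ; zero; suc)
import Data.Nat as ℕ
open import Data.Fin using (Fin; zero; suc)
open import Data.Integer using (ℤ; +_; -_; _+_; _*_; _-_)
open import Data.Integer.Divisibility using (_∣_)
open import Data.Product using (_×_)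
open import Data.Sum using (_⊎_)
open import Relation.Nullary using (¬_; Dec; yes; no)
open import Relation.Binary.PropositionalEquality using (_≡_)

sumℤ : {n : ℕ} → (Fin n → ℤ) → ℤ
sumℤ {zero}  f = + 0
sumℤ {suc n} f = f zero + sumℤ (λ i → f (suc i))

countFin : {n : ℕ} {P : Fin n → Set} → ((i : Fin n) → Dec (P i)) → ℕ
countFin {zero}  d = 0
countFin {suc n} d with d zero
... | yes _ = suc (countFin (λ i → d (suc i)))
... | no  _ = countFin (λ i → d (suc i))

Matrix : ℕ → Set
Matrix N = Fin N → Fin N → ℤ

IsSignMatrix : {N : ℕ} → Matrix N → Set
IsSignMatrix {N} H = (i j : Fin N) → (H i j ≡ + 1) ⊎ (H i j ≡ - (+ 1))

-- rows pairwise orthogonal in ℝ^N (entries are integers, so the inner product is computed in ℤ)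
RowsOrthogonal : {N : ℕ} → Matrix N → Set
RowsOrthogonal {N} H = (i k : Fin N) → ¬ (i ≡ k) → sumℤ (λ j → H i j * H k j) ≡ + 0

IsHadamard : {N : ℕ} → Matrix N → Set
IsHadamard H = IsSignMatrix H × RowsOrthogonal H

rowSum : {N : ℕ} → Matrix N → Fin N → ℤ
rowSum H i = sumℤ (H i)

_≡_[mod_] : ℤ → ℤ → ℤ → Set
a ≡ b [mod m ] = m ∣ (a - b)

open import Data.Nat.Divisibility using (_∣?_)
open import Data.Integer using (∣_∣)

_≡?_[mod_] : (a b m : ℤ) → Dec (a ≡ b [mod m ])
a ≡? b [mod m ] = ∣ m ∣ ∣? ∣ a - b ∣

module Submission where

-- For signs x, y, z one has (x + y)(x + z) ∈ {0, 4}.  Summing this over the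
-- columns of three distinct rows gives 4 ∣ N; summing it for 𝟙, Hₖ, Hᵢ gives
-- 4 ∣ N + Sᵢ + Sₖ.  As every entry is odd, Sᵢ ≡ N ≡ 0 (mod 2), and then
-- Sᵢ − Sₖ = (N + Sᵢ + Sₖ) − N − 2Sₖ ≡ 0 (mod 4).
--
-- The key fact is Parseval's identity Σᵢ Sᵢ² = N² (𝟙 has squared length N
-- and its coordinates in the orthogonal basis of rows are the Sᵢ).  Over ℤ we derive
-- it without inverting H: any N+1 vectors of ℤᴺ satisfy a nontrivial integer relation,
-- and pairing a relation among 𝟙, H₁, …, H_N with each row and with 𝟙 forces Σ Sᵢ² = N².
-- If 4 ∣ Sᵢ then Sᵢ² ≡ 16·[Sᵢ ≡ 4 (mod 8)] (mod 32), so N² ≡ 16·#{i : Sᵢ ≡ 4 (mod 8)}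
-- (mod 32), while N² ≡ 16 or 0 (mod 32) according as N ≡ 4 or 0 (mod 8).

open import Defs
open import Data.Nat as ℕ using (ℕ; zero; suc; _≥_; _%_; s≤s)
open import Data.Fin using (Fin; zero; suc; punchIn; punchOut; _≟_)
open import Data.Fin.Properties using (punchInᵢ≢i; punchIn-punchOut; ¬∀⟶∃¬; all?)
open import Data.Integer using (ℤ; +_; -_; _+_; _*_; _-_; ∣_∣; _%ℕ_; _/ℕ_; ≢-nonZero)
import Data.Integer.DivMod as ℤ
import Data.Nat.DivMod as ℕ
import Data.Nat.Divisibility as ℕ
import Data.Integer.Properties as ℤ
open import Data.Integer.Divisibility.Signed
  using (divides; ∣m∣n⇒∣m+n; ∣m∣n⇒∣m-n; ∣m⇒∣m*n; ∣-trans; *-monoʳ-∣; *-monoˡ-∣; *-cancelˡ-∣; ∣ᵤ⇒∣; ∣⇒∣ᵤ)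
  renaming (_∣_ to _∣ₛ_)
open import Data.Integer.Divisibility using (_∣_)
open import Data.Integer.Tactic.RingSolver using (solve-∀)
open import Data.Product using (_×_; _,_; ∃; proj₁)
open import Data.Sum using (_⊎_; inj₁; inj₂)
open import Function using (_∘_; case_of_)
open import Relation.Nullary using (¬_; Dec; yes; no)
open import Data.Empty using (⊥-elim)
open import Relation.Binary.PropositionalEquality
open ≡-Reasoning

open import Algebra.Properties.Semiring.Sum ℤ.+-*-semiring
  using (sum; sum-syntax; sum-cong-≗; ∑-distrib-+; ∑-comm; *-distribˡ-sum; sum-remove; sum-replicate-zero)

sumℤ≡sum : ∀ {n} (f : Fin n → ℤ) → sumℤ f ≡ sum f
sumℤ≡sum {zero}  f = refl
sumℤ≡sum {suc n} f = cong (_+_ (f zero)) (sumℤ≡sum (f ∘ suc))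

∑-scale : ∀ {n} (a : ℤ) (f : Fin n → ℤ) → ∑[ i < n ] (a * f i) ≡ a * sum f
∑-scale a f = sym (*-distribˡ-sum a f)

∑-zero : ∀ {n} {f : Fin n → ℤ} → (∀ i → f i ≡ + 0) → sum f ≡ + 0
∑-zero {n} f≗0 = trans (sum-cong-≗ f≗0) (sum-replicate-zero n)

∑-delta : ∀ {n} (f : Fin n → ℤ) (k : Fin n) → (∀ i → i ≢ k → f i ≡ + 0) → sum f ≡ f k
∑-delta {suc n} f k off-k = begin
  sum f                           ≡⟨ sum-remove {i = k} f ⟩
  f k + sum (f ∘ punchIn k)       ≡⟨ cong (_+_ (f k)) (∑-zero (λ i → off-k (punchIn k i) (punchInᵢ≢i k i))) ⟩
  f k + + 0                       ≡⟨ ℤ.+-identityʳ (f k) ⟩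
  f k                             ∎

∑-ones : ∀ n → ∑[ i < n ] (+ 1) ≡ + n
∑-ones zero    = refl
∑-ones (suc n) = cong (_+_ (+ 1)) (∑-ones n)

∑-multiple : ∀ {n d} {f : Fin n → ℤ} → (∀ i → d ∣ₛ f i) → d ∣ₛ sum f
∑-multiple {zero}  {d} _        = divides (+ 0) (sym (ℤ.*-zeroˡ d))
∑-multiple {suc n} d∣f = ∣m∣n⇒∣m+n (d∣f zero) (∑-multiple (d∣f ∘ suc))

∑-linear : ∀ {n} (a b : ℤ) (f g : Fin n → ℤ) →
  ∑[ i < n ] (a * f i + b * g i) ≡ a * sum f + b * sum g
∑-linear a b f g = trans (∑-distrib-+ (λ i → a * f i) (λ i → b * g i)) (cong₂ _+_ (∑-scale a f) (∑-scale b g))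

IsRelation : ∀ {r n} → (Fin r → ℤ) → (Fin r → Fin n → ℤ) → Set
IsRelation {r} c v = ∀ j → ∑[ i < r ] (c i * v i j) ≡ + 0

NonTrivial : ∀ {r} → (Fin r → ℤ) → Set
NonTrivial c = ∃ λ i → c i ≢ + 0

e₀ : ∀ {r} → Fin (suc r) → ℤ
e₀ zero    = + 1
e₀ (suc _) = + 0

e₀-relation : ∀ {r n} (v : Fin (suc r) → Fin n → ℤ) → (∀ j → v zero j ≡ + 0) → IsRelation e₀ v
e₀-relation {r} v v₀≡0 j = begin
  + 1 * v zero j + ∑[ p < r ] (+ 0 * v (suc p) j)   ≡⟨ cong₂ _+_ (ℤ.*-identityˡ (v zero j)) (∑-zero {f = λ p → + 0 * v (suc p) j} (λ _ → refl)) ⟩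
  v zero j + + 0                                      ≡⟨ ℤ.+-identityʳ (v zero j) ⟩
  v zero j                                            ≡⟨ v₀≡0 j ⟩
  + 0                                                 ∎

-- One step of Gaussian elimination on vectors v₀, v₁, …, v_r of ℤⁿ with pivot coordinate k.
module Elimination {r n} (v : Fin (suc r) → Fin n → ℤ) (k : Fin n) where

  a : ℤ
  a = v zero k

  w : Fin r → Fin n → ℤ
  w p j = a * v (suc p) j - v (suc p) k * v zero j

  w-vanishes : ∀ p → w p k ≡ + 0
  w-vanishes p = cancel a (v (suc p) k)
    where
    cancel : ∀ x y → x * y - y * x ≡ + 0
    cancel = solve-∀

  lift : (Fin r → ℤ) → Fin (suc r) → ℤ
  lift c′ zero    = - ∑[ p < r ] (c′ p * v (suc p) k)
  lift c′ (suc p) = a * c′ p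

  lift-nontrivial : a ≢ + 0 → ∀ {c′} → NonTrivial c′ → NonTrivial (lift c′)
  lift-nontrivial a≢0 (p , c′ₚ≢0) = suc p , λ ac′ₚ≡0 → case ℤ.i*j≡0⇒i≡0∨j≡0 a ac′ₚ≡0 of λ
    { (inj₁ a≡0)   → a≢0 a≡0
    ; (inj₂ c′ₚ≡0) → c′ₚ≢0 c′ₚ≡0 }

  lift-combination : ∀ c′ j → ∑[ i < suc r ] (lift c′ i * v i j) ≡ ∑[ p < r ] (c′ p * w p j)
  lift-combination c′ j = begin
    (- B) * v zero j + ∑[ p < r ] ((a * c′ p) * v (suc p) j)
      ≡⟨ cong (_+_ ((- B) * v zero j)) (trans (sum-cong-≗ (λ p → ℤ.*-assoc a (c′ p) (v (suc p) j))) (∑-scale a (λ p → c′ p * v (suc p) j))) ⟩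
    (- B) * v zero j + a * ∑[ p < r ] (c′ p * v (suc p) j)
      ≡⟨ swap B (v zero j) a (∑[ p < r ] (c′ p * v (suc p) j)) ⟩
    a * ∑[ p < r ] (c′ p * v (suc p) j) + (- v zero j) * B
      ≡⟨ ∑-linear a (- v zero j) (λ p → c′ p * v (suc p) j) (λ p → c′ p * v (suc p) k) ⟨
    ∑[ p < r ] (a * (c′ p * v (suc p) j) + (- v zero j) * (c′ p * v (suc p) k))
      ≡⟨ sum-cong-≗ (λ p → distribute (c′ p) a (v (suc p) j) (v (suc p) k) (v zero j)) ⟩
    ∑[ p < r ] (c′ p * w p j) ∎
    where
    B = ∑[ p < r ] (c′ p * v (suc p) k)
    swap : ∀ B z a A → (- B) * z + a * A ≡ a * A + (- z) * B
    swap = solve-∀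
    distribute : ∀ c a x y z → a * (c * x) + (- z) * (c * y) ≡ c * (a * x - y * z)
    distribute = solve-∀

-- A relation among the wₚ with coordinate k deleted lifts to a relation among the vᵢ:
-- at coordinate k the wₚ vanish, and every other coordinate is punchIn k of a kept one.
lift-relation : ∀ {r m} (v : Fin (suc r) → Fin (suc m) → ℤ) (k : Fin (suc m)) (c′ : Fin r → ℤ) →
  let open Elimination v k in IsRelation c′ (λ p j′ → w p (punchIn k j′)) → IsRelation (lift c′) v
lift-relation {r} v k c′ relation j with k ≟ j
... | yes refl = trans (lift-combination c′ k) (∑-zero {f = λ p → c′ p * w p k} (λ p → trans (cong (c′ p *_) (w-vanishes p)) (ℤ.*-zeroʳ (c′ p))))
  where open Elimination v k
... | no k≢j = begin
  ∑[ i < suc r ] (lift c′ i * v i j)                      ≡⟨ lift-combination c′ j ⟩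
  ∑[ p < r ] (c′ p * w p j)                               ≡⟨ cong (λ j → ∑[ p < r ] (c′ p * w p j)) (punchIn-punchOut k≢j) ⟨
  ∑[ p < r ] (c′ p * w p (punchIn k (punchOut k≢j)))      ≡⟨ relation (punchOut k≢j) ⟩
  + 0                                                     ∎
  where open Elimination v k

-- If v₀ = 0 take e₀;
-- otherwise eliminate a coordinate k with v₀ₖ ≠ 0 and lift a relation among the
-- n remaining vectors of ℤⁿ⁻¹ given by induction.
integer-relation : ∀ n (v : Fin (suc n) → Fin n → ℤ) → ∃ λ c → NonTrivial c × IsRelation c v
integer-relation zero    v = (λ _ → + 1) , (zero , λ ()) , λ ()
integer-relation (suc n) v with all? (λ j → v zero j ℤ.≟ + 0)
... | yes v₀≡0 = e₀ , (zero , λ ()) , e₀-relation v v₀≡0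
... | no v₀≢0 with ¬∀⟶∃¬ (suc n) _ (λ j → v zero j ℤ.≟ + 0) v₀≢0
... | k , v₀ₖ≢0 with integer-relation n (λ p j′ → Elimination.w v k p (punchIn k j′))
... | c′ , nontrivial , relation =
  Elimination.lift v k c′ , Elimination.lift-nontrivial v k v₀ₖ≢0 nontrivial , lift-relation v k c′ relation

_·_ : ∀ {n} → (Fin n → ℤ) → (Fin n → ℤ) → ℤ
_·_ {n} x y = ∑[ j < n ] (x j * y j)

𝟙 : ∀ {n} → Fin n → ℤ
𝟙 _ = + 1

𝟙-·ʳ : ∀ {n} (x : Fin n → ℤ) → x · 𝟙 ≡ sum x
𝟙-·ʳ x = sum-cong-≗ (λ j → ℤ.*-identityʳ (x j))

𝟙-·ˡ : ∀ {n} (x : Fin n → ℤ) → 𝟙 · x ≡ sum x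
𝟙-·ˡ x = sum-cong-≗ (λ j → ℤ.*-identityˡ (x j))

·-combination : ∀ {r n} (y : Fin n → ℤ) (c : Fin r → ℤ) (v : Fin r → Fin n → ℤ) →
  y · (λ j → ∑[ i < r ] (c i * v i j)) ≡ ∑[ i < r ] (c i * (y · v i))
·-combination {r} {n} y c v = begin
  ∑[ j < n ] (y j * ∑[ i < r ] (c i * v i j))   ≡⟨ sum-cong-≗ (λ j → trans (*-distribˡ-sum (y j) (λ i → c i * v i j)) (sum-cong-≗ (λ i → regroup (y j) (c i) (v i j)))) ⟩
  ∑[ j < n ] ∑[ i < r ] (c i * (y j * v i j))   ≡⟨ ∑-comm (λ j i → c i * (y j * v i j)) ⟩
  ∑[ i < r ] ∑[ j < n ] (c i * (y j * v i j))   ≡⟨ sum-cong-≗ (λ i → ∑-scale (c i) (λ j → y j * v i j)) ⟩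
  ∑[ i < r ] (c i * (y · v i))                  ∎
  where
  regroup : ∀ y c x → y * (c * x) ≡ c * (y * x)
  regroup = solve-∀

pair-relation : ∀ {r n} (c : Fin r → ℤ) (v : Fin r → Fin n → ℤ) → IsRelation c v →
  ∀ y → ∑[ i < r ] (c i * (y · v i)) ≡ + 0
pair-relation {r} {n} c v rel y = begin
  ∑[ i < r ] (c i * (y · v i))                  ≡⟨ ·-combination y c v ⟨
  y · (λ j → ∑[ i < r ] (c i * v i j))          ≡⟨ ∑-zero {f = λ j → y j * ∑[ i < r ] (c i * v i j)} (λ j → trans (cong (y j *_) (rel j)) (ℤ.*-zeroʳ (y j))) ⟩
  + 0                                           ∎

-- Multiplying the k-th equation by Sₖ and summing gives
-- n·Σₖ cₖ₊₁Sₖ = −c₀ Σₖ Sₖ², the last equation gives Σₖ cₖ₊₁Sₖ = −c₀ n, and c₀ ≠ 0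
-- because c₀ = 0 would force every cₖ₊₁ n, hence every cₖ₊₁, to vanish.
squares-from-relation : ∀ n (S : Fin n → ℤ) (c : Fin (suc n) → ℤ) → NonTrivial c →
  (∀ k → c zero * S k + c (suc k) * + n ≡ + 0) →
  c zero * + n + ∑[ k < n ] (c (suc k) * S k) ≡ + 0 →
  ∑[ k < n ] (S k * S k) ≡ + n * + n
squares-from-relation zero    S c nontrivial row ones = refl
squares-from-relation n@(suc _) S c nontrivial row ones =
  ℤ.*-cancelˡ-≡ c₀ Q (+ n * + n) {{≢-nonZero (c₀≢0 nontrivial)}} (trans c₀Q≡-nT (sym c₀n²≡-nT))
  where
  c₀ = c zero
  T = ∑[ k < n ] (c (suc k) * S k)
  Q = ∑[ k < n ] (S k * S k)

  c₀≢0 : NonTrivial c → c₀ ≢ + 0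
  c₀≢0 (zero  , c₀≢0) = c₀≢0
  c₀≢0 (suc k , cₖ≢0) = λ c₀≡0 → cₖ≢0 (cancel-n (begin
    c (suc k) * + n                    ≡⟨ ℤ.+-identityˡ _ ⟨
    + 0 + c (suc k) * + n              ≡⟨ cong (λ t → t + c (suc k) * + n) (ℤ.*-zeroˡ (S k)) ⟨
    + 0 * S k + c (suc k) * + n        ≡⟨ cong (λ t → t * S k + c (suc k) * + n) c₀≡0 ⟨
    c₀ * S k + c (suc k) * + n         ≡⟨ row k ⟩
    + 0                                ∎))
    where
    cancel-n : c (suc k) * + n ≡ + 0 → c (suc k) ≡ + 0
    cancel-n e with ℤ.i*j≡0⇒i≡0∨j≡0 (c (suc k)) e
    ... | inj₁ cₖ≡0 = cₖ≡0

  c₀n²≡-nT : c₀ * (+ n * + n) ≡ - (+ n * T)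
  c₀n²≡-nT = begin
    c₀ * (+ n * + n)                    ≡⟨ expand c₀ (+ n) T ⟩
    + n * (c₀ * + n + T) - + n * T      ≡⟨ cong (λ t → + n * t - + n * T) ones ⟩
    + n * + 0 - + n * T                 ≡⟨ collapse (+ n) (+ n * T) ⟩
    - (+ n * T)                         ∎
    where
    expand : ∀ c n T → c * (n * n) ≡ n * (c * n + T) - n * T
    expand = solve-∀
    collapse : ∀ n x → n * + 0 - x ≡ - x
    collapse = solve-∀

  nT≡-c₀Q : + n * T ≡ (- c₀) * Q
  nT≡-c₀Q = begin
    + n * T                                  ≡⟨ ∑-scale (+ n) (λ k → c (suc k) * S k) ⟨
    ∑[ k < n ] (+ n * (c (suc k) * S k))     ≡⟨ sum-cong-≗ termwise ⟩
    ∑[ k < n ] ((- c₀) * (S k * S k))        ≡⟨ ∑-scale (- c₀) (λ k → S k * S k) ⟩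
    (- c₀) * Q                               ∎
    where
    split : ∀ c₀ S c n → n * (c * S) ≡ (c₀ * S + c * n) * S + (- c₀) * (S * S)
    split = solve-∀
    termwise : ∀ k → + n * (c (suc k) * S k) ≡ (- c₀) * (S k * S k)
    termwise k = begin
      + n * (c (suc k) * S k)                              ≡⟨ split c₀ (S k) (c (suc k)) (+ n) ⟩
      (c₀ * S k + c (suc k) * + n) * S k + (- c₀) * (S k * S k) ≡⟨ cong (λ t → t * S k + (- c₀) * (S k * S k)) (row k) ⟩
      + 0 * S k + (- c₀) * (S k * S k)                    ≡⟨ cong (_+ (- c₀) * (S k * S k)) (ℤ.*-zeroˡ (S k)) ⟩
      + 0 + (- c₀) * (S k * S k)                          ≡⟨ ℤ.+-identityˡ _ ⟩
      (- c₀) * (S k * S k)                                ∎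

  c₀Q≡-nT : c₀ * Q ≡ - (+ n * T)
  c₀Q≡-nT = trans (double-negation c₀ Q) (cong -_ (sym nT≡-c₀Q))
    where
    double-negation : ∀ c Q → c * Q ≡ - ((- c) * Q)
    double-negation = solve-∀

Sign : ℤ → Set
Sign x = (x ≡ + 1) ⊎ (x ≡ - (+ 1))

sign-square : ∀ {x} → Sign x → x * x ≡ + 1
sign-square (inj₁ refl) = refl
sign-square (inj₂ refl) = refl

sign-norm : ∀ {n} {x : Fin n → ℤ} → (∀ j → Sign (x j)) → x · x ≡ + n
sign-norm {n} signs = trans (sum-cong-≗ (λ j → sign-square (signs j))) (∑-ones n)

rows-orthogonal : ∀ {N} {H : Matrix N} → RowsOrthogonal H → ∀ i k → i ≢ k → H i · H k ≡ + 0
rows-orthogonal {H = H} orthogonal i k i≢k = trans (sym (sumℤ≡sum (λ j → H i j * H k j))) (orthogonal i k i≢k)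

row-coefficient : ∀ {N} {H : Matrix N} → IsHadamard H → ∀ (d : Fin N → ℤ) k →
  ∑[ i < N ] (d i * (H k · H i)) ≡ d k * + N
row-coefficient {N} {H} (signs , orthogonal) d k = begin
  ∑[ i < N ] (d i * (H k · H i))   ≡⟨ ∑-delta (λ i → d i * (H k · H i)) k off-diagonal ⟩
  d k * (H k · H k)                ≡⟨ cong (d k *_) (sign-norm (signs k)) ⟩
  d k * + N                        ∎
  where
  off-diagonal : ∀ i → i ≢ k → d i * (H k · H i) ≡ + 0
  off-diagonal i i≢k = trans (cong (d i *_) (rows-orthogonal {H = H} orthogonal k i (i≢k ∘ sym))) (ℤ.*-zeroʳ (d i))

𝟙-and-rows : ∀ {N} → Matrix N → Fin (suc N) → Fin N → ℤ
𝟙-and-rows H zero    = 𝟙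
𝟙-and-rows H (suc i) = H i

-- The N+1 vectors 𝟙, H₀, …, H_{N−1} satisfy a nontrivial relation; pairing it with
-- each row and with 𝟙 gives the hypotheses of squares-from-relation.
parseval : ∀ {N} {H : Matrix N} → IsHadamard H → ∑[ i < N ] (rowSum H i * rowSum H i) ≡ + N * + N
parseval {N} {H} hadamard with integer-relation N (𝟙-and-rows H)
... | c , nontrivial , relation = squares-from-relation N (rowSum H) c nontrivial paired-with-row paired-with-𝟙
  where
  paired-with-row : ∀ k → c zero * rowSum H k + c (suc k) * + N ≡ + 0
  paired-with-row k = begin
    c zero * rowSum H k + c (suc k) * + N
      ≡⟨ cong₂ (λ s t → c zero * s + t) (trans (sumℤ≡sum (H k)) (sym (𝟙-·ʳ (H k)))) (sym (row-coefficient hadamard (c ∘ suc) k)) ⟩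
    c zero * (H k · 𝟙) + ∑[ i < N ] (c (suc i) * (H k · H i))
      ≡⟨ pair-relation c (𝟙-and-rows H) relation (H k) ⟩
    + 0 ∎
  paired-with-𝟙 : c zero * + N + ∑[ k < N ] (c (suc k) * rowSum H k) ≡ + 0
  paired-with-𝟙 = begin
    c zero * + N + ∑[ k < N ] (c (suc k) * rowSum H k)
      ≡⟨ cong₂ (λ s t → c zero * s + t) (sym (∑-ones N)) (sum-cong-≗ (λ k → cong (c (suc k) *_) (trans (sumℤ≡sum (H k)) (sym (𝟙-·ˡ (H k)))))) ⟩
    c zero * (𝟙 {N} · 𝟙) + ∑[ k < N ] (c (suc k) * (𝟙 · H k))
      ≡⟨ pair-relation c (𝟙-and-rows H) relation 𝟙 ⟩
    + 0 ∎

sign-odd : ∀ {x} → Sign x → + 2 ∣ₛ x + + 1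
sign-odd (inj₁ refl) = divides (+ 1) refl
sign-odd (inj₂ refl) = divides (+ 0) refl

sign-product-mod-4 : ∀ {x y z} → Sign x → Sign y → Sign z → + 4 ∣ₛ (x + y) * (x + z)
sign-product-mod-4 (inj₁ refl) (inj₁ refl) (inj₁ refl) = divides (+ 1) refl
sign-product-mod-4 (inj₁ refl) (inj₁ refl) (inj₂ refl) = divides (+ 0) refl
sign-product-mod-4 (inj₁ refl) (inj₂ refl) (inj₁ refl) = divides (+ 0) refl
sign-product-mod-4 (inj₁ refl) (inj₂ refl) (inj₂ refl) = divides (+ 0) refl
sign-product-mod-4 (inj₂ refl) (inj₁ refl) (inj₁ refl) = divides (+ 0) refl
sign-product-mod-4 (inj₂ refl) (inj₁ refl) (inj₂ refl) = divides (+ 0) refl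
sign-product-mod-4 (inj₂ refl) (inj₂ refl) (inj₁ refl) = divides (+ 0) refl
sign-product-mod-4 (inj₂ refl) (inj₂ refl) (inj₂ refl) = divides (+ 1) refl

∑-expand : ∀ {n} (x y z : Fin n → ℤ) →
  ∑[ j < n ] ((x j + y j) * (x j + z j)) ≡ x · x + x · z + y · x + y · z
∑-expand {n} x y z = begin
  ∑[ j < n ] ((x j + y j) * (x j + z j))
    ≡⟨ sum-cong-≗ (λ j → multiply-out (x j) (y j) (z j)) ⟩
  ∑[ j < n ] (x j * x j + x j * z j + y j * x j + y j * z j)
    ≡⟨ ∑-distrib-+ (λ j → x j * x j + x j * z j + y j * x j) (λ j → y j * z j) ⟩
  ∑[ j < n ] (x j * x j + x j * z j + y j * x j) + y · z
    ≡⟨ cong (_+ y · z) (∑-distrib-+ (λ j → x j * x j + x j * z j) (λ j → y j * x j)) ⟩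
  ∑[ j < n ] (x j * x j + x j * z j) + y · x + y · z
    ≡⟨ cong (λ t → t + y · x + y · z) (∑-distrib-+ (λ j → x j * x j) (λ j → x j * z j)) ⟩
  x · x + x · z + y · x + y · z ∎
  where
  multiply-out : ∀ a b c → (a + b) * (a + c) ≡ a * a + a * c + b * a + b * c
  multiply-out = solve-∀

sign-vectors-mod-4 : ∀ {n} (x y z : Fin n → ℤ) → (∀ j → Sign (x j)) → (∀ j → Sign (y j)) → (∀ j → Sign (z j)) →
  + 4 ∣ₛ x · x + x · z + y · x + y · z
sign-vectors-mod-4 x y z sx sy sz =
  subst (+ 4 ∣ₛ_) (∑-expand x y z) (∑-multiple (λ j → sign-product-mod-4 (sx j) (sy j) (sz j)))

-- Three distinct rows a, b, c give N = Hₐ·Hₐ + Hₐ·H_c + H_b·Hₐ + H_b·H_c ≡ 0 (mod 4).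
order-mod-4 : ∀ {N} {H : Matrix N} → IsHadamard H → ∀ {a b c} → a ≢ c → b ≢ a → b ≢ c → + 4 ∣ₛ + N
order-mod-4 {N} {H} (signs , orthogonal) {a} {b} {c} a≢c b≢a b≢c =
  subst (+ 4 ∣ₛ_) N-as-products (sign-vectors-mod-4 (H a) (H b) (H c) (signs a) (signs b) (signs c))
  where
  ⊥-rows = rows-orthogonal {H = H} orthogonal
  N-as-products : H a · H a + H a · H c + H b · H a + H b · H c ≡ + N
  N-as-products = begin
    H a · H a + H a · H c + H b · H a + H b · H c
      ≡⟨ cong₂ _+_ (cong₂ _+_ (cong₂ _+_ (sign-norm (signs a)) (⊥-rows a c a≢c)) (⊥-rows b a b≢a)) (⊥-rows b c b≢c) ⟩
    + N + + 0 + + 0 + + 0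
      ≡⟨ drop-zeros (+ N) ⟩
    + N ∎
    where
    drop-zeros : ∀ n → n + + 0 + + 0 + + 0 ≡ n
    drop-zeros = solve-∀

-- Two distinct rows i, k give N + Sᵢ + Sₖ = 𝟙·𝟙 + 𝟙·Hᵢ + Hₖ·𝟙 + Hₖ·Hᵢ ≡ 0 (mod 4).
row-sums-mod-4 : ∀ {N} {H : Matrix N} → IsHadamard H → ∀ {i k} → i ≢ k →
  + 4 ∣ₛ + N + rowSum H i + rowSum H k
row-sums-mod-4 {N} {H} (signs , orthogonal) {i} {k} i≢k =
  subst (+ 4 ∣ₛ_) sums-as-products (sign-vectors-mod-4 𝟙 (H k) (H i) (λ _ → inj₁ refl) (signs k) (signs i))
  where
  sums-as-products : 𝟙 {N} · 𝟙 + 𝟙 · H i + H k · 𝟙 + H k · H i ≡ + N + rowSum H i + rowSum H k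
  sums-as-products = begin
    𝟙 {N} · 𝟙 + 𝟙 · H i + H k · 𝟙 + H k · H i
      ≡⟨ cong₂ _+_ (cong₂ _+_ (cong₂ _+_ (∑-ones N) (𝟙-·ˡ (H i))) (𝟙-·ʳ (H k))) (rows-orthogonal {H = H} orthogonal k i (i≢k ∘ sym)) ⟩
    + N + sum (H i) + sum (H k) + + 0
      ≡⟨ ℤ.+-identityʳ _ ⟩
    + N + sum (H i) + sum (H k)
      ≡⟨ cong₂ (λ s t → + N + s + t) (sumℤ≡sum (H i)) (sumℤ≡sum (H k)) ⟨
    + N + rowSum H i + rowSum H k ∎

-- Every entry is odd, so Sᵢ ≡ N (mod 2).
row-sum-parity : ∀ {N} {H : Matrix N} → IsSignMatrix H → ∀ i → + 2 ∣ₛ rowSum H i + + N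
row-sum-parity {N} {H} signs i = subst (+ 2 ∣ₛ_) sum-of-odd-entries (∑-multiple (λ j → sign-odd (signs i j)))
  where
  sum-of-odd-entries : ∑[ j < N ] (H i j + + 1) ≡ rowSum H i + + N
  sum-of-odd-entries = begin
    ∑[ j < N ] (H i j + + 1)     ≡⟨ ∑-distrib-+ (H i) 𝟙 ⟩
    sum (H i) + ∑[ j < N ] (+ 1) ≡⟨ cong₂ _+_ (sym (sumℤ≡sum (H i))) (∑-ones N) ⟩
    rowSum H i + + N             ∎

row-sum-even : ∀ {N} {H : Matrix N} → IsSignMatrix H → + 4 ∣ₛ + N → ∀ i → + 2 ∣ₛ rowSum H i
row-sum-even {N} {H} signs 4∣N i =
  subst (+ 2 ∣ₛ_) (cancel (rowSum H i) (+ N)) (∣m∣n⇒∣m-n (row-sum-parity signs i) (∣-trans (divides (+ 2) refl) 4∣N))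
  where
  cancel : ∀ s n → s + n - n ≡ s
  cancel = solve-∀

row-sums-congruent : ∀ {N} {H : Matrix N} → IsHadamard H → + 4 ∣ₛ + N → ∀ i k → + 4 ∣ₛ rowSum H i - rowSum H k
row-sums-congruent {N} {H} hadamard 4∣N i k with i ≟ k
... | yes refl = divides (+ 0) (ℤ.+-inverseʳ (rowSum H i))
... | no i≢k = subst (+ 4 ∣ₛ_) (regroup (+ N) (rowSum H i) (rowSum H k))
  (∣m∣n⇒∣m-n (∣m∣n⇒∣m-n (row-sums-mod-4 hadamard i≢k) 4∣N) (*-monoʳ-∣ (+ 2) (row-sum-even (proj₁ hadamard) 4∣N k)))
  where
  regroup : ∀ n s t → n + s + t - n - + 2 * t ≡ s - t
  regroup = solve-∀

remainder-divides : ∀ a d .{{_ : ℕ.NonZero d}} → + d ∣ₛ a - + (a %ℕ d)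
remainder-divides a d = divides (a /ℕ d) (begin
  a - + r                  ≡⟨ cong (_- + r) (ℤ.a≡a%ℕn+[a/ℕn]*n a d) ⟩
  + r + q * + d - + r      ≡⟨ cancel (+ r) (q * + d) ⟩
  q * + d                  ∎)
  where
  r = a %ℕ d
  q = a /ℕ d
  cancel : ∀ r x → r + x - r ≡ x
  cancel = solve-∀

parity : ∀ u → + 2 ∣ₛ u ⊎ + 2 ∣ₛ u - + 1
parity u with u %ℕ 2 | ℤ.n%ℕd<d u 2 | remainder-divides u 2
... | 0           | _                 | 2∣u-0 = inj₁ (subst (+ 2 ∣ₛ_) (ℤ.+-identityʳ u) 2∣u-0)
... | 1           | _                 | 2∣u-1 = inj₂ 2∣u-1
... | suc (suc _) | s≤s (s≤s ()) | _

two∤unit : ∀ {x} → ∣ x ∣ ≡ 1 → ¬ (+ 2 ∣ₛ x)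
two∤unit ∣x∣≡1 2∣x with ℕ.∣1⇒≡1 (subst (2 ℕ.∣_) ∣x∣≡1 (∣⇒∣ᵤ 2∣x))
... | ()

parity-agrees : ∀ a b → + 2 ∣ₛ + a - + b → a % 2 ≡ b % 2
parity-agrees a b 2∣a-b = remainders-agree (a % 2) (b % 2) (ℕ.m%n<n a 2) (ℕ.m%n<n b 2)
  (subst (+ 2 ∣ₛ_) (regroup (+ a) (+ b) (+ (a % 2)) (+ (b % 2)))
    (∣m∣n⇒∣m+n (∣m∣n⇒∣m-n 2∣a-b (remainder-divides (+ a) 2)) (remainder-divides (+ b) 2)))
  where
  regroup : ∀ a b r s → a - b - (a - r) + (b - s) ≡ r - s
  regroup = solve-∀
  remainders-agree : ∀ r s → r ℕ.< 2 → s ℕ.< 2 → + 2 ∣ₛ + r - + s → r ≡ s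
  remainders-agree 0 0 _ _ _ = refl
  remainders-agree 1 1 _ _ _ = refl
  remainders-agree 0 1 _ _ 2∣-1 = ⊥-elim (two∤unit refl 2∣-1)
  remainders-agree 1 0 _ _ 2∣1 = ⊥-elim (two∤unit refl 2∣1)
  remainders-agree (suc (suc _)) _ (s≤s (s≤s ())) _ _
  remainders-agree _ (suc (suc _)) _ (s≤s (s≤s ())) _

-- If a ≡ b (mod 8) and b is even then a² ≡ b² (mod 32), as a² − b² = (a − b)² + 2b(a − b).
squares-mod-32 : ∀ {a b} → + 8 ∣ₛ a - b → + 2 ∣ₛ b → + 32 ∣ₛ a * a - b * b
squares-mod-32 {a} {b} (divides q a-b≡8q) (divides s b≡2s) = divides (+ 2 * q * q + q * s) (begin
  a * a - b * b                                 ≡⟨ complete-square a b ⟩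
  (a - b) * (a - b) + + 2 * b * (a - b)         ≡⟨ cong₂ (λ d e → d * d + + 2 * e * d) a-b≡8q b≡2s ⟩
  (q * + 8) * (q * + 8) + + 2 * (s * + 2) * (q * + 8)  ≡⟨ factor q s ⟩
  (+ 2 * q * q + q * s) * + 32                  ∎)
  where
  complete-square : ∀ a b → a * a - b * b ≡ (a - b) * (a - b) + + 2 * b * (a - b)
  complete-square = solve-∀
  factor : ∀ q s → (q * + 8) * (q * + 8) + + 2 * (s * + 2) * (q * + 8) ≡ (+ 2 * q * q + q * s) * + 32
  factor = solve-∀

-- A multiple of 4 is ≡ 0 or ≡ 4 (mod 8), according to the parity of its quotient.
multiple-of-4-mod-8 : ∀ {x} → + 4 ∣ₛ x → + 8 ∣ₛ x ⊎ + 8 ∣ₛ x - + 4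
multiple-of-4-mod-8 (divides u refl) with parity u
... | inj₁ 2∣u   = inj₁ (*-monoˡ-∣ (+ 4) 2∣u)
... | inj₂ 2∣u-1 = inj₂ (subst (+ 8 ∣ₛ_) (distribute u) (*-monoˡ-∣ (+ 4) 2∣u-1))
  where
  distribute : ∀ u → (u - + 1) * + 4 ≡ u * + 4 - + 4
  distribute = solve-∀

indicator : ∀ {P : Set} → Dec P → ℤ
indicator (yes _) = + 1
indicator (no _)  = + 0

countFin≡∑ : ∀ {n} {P : Fin n → Set} (P? : ∀ i → Dec (P i)) → + countFin P? ≡ ∑[ i < n ] indicator (P? i)
countFin≡∑ {zero}  P? = refl
countFin≡∑ {suc n} P? with P? zero
... | yes _ = cong (_+_ (+ 1)) (countFin≡∑ (P? ∘ suc))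
... | no  _ = trans (countFin≡∑ (P? ∘ suc)) (sym (ℤ.+-identityˡ _))

square-of-multiple-of-4 : ∀ {x} → + 4 ∣ₛ x → + 32 ∣ₛ x * x - + 16 * indicator (x ≡? + 4 [mod + 8 ])
square-of-multiple-of-4 {x} 4∣x with x ≡? + 4 [mod + 8 ] | multiple-of-4-mod-8 4∣x
... | yes x≡4 | _        = squares-mod-32 {x} {+ 4} (∣ᵤ⇒∣ x≡4) (divides (+ 2) refl)
... | no _    | inj₁ 8∣x = squares-mod-32 {x} {+ 0} (subst (+ 8 ∣ₛ_) (sym (ℤ.+-identityʳ x)) 8∣x) (divides (+ 0) refl)
... | no x≢4  | inj₂ 8∣x-4 = ⊥-elim (x≢4 (∣⇒∣ᵤ 8∣x-4))

sum-of-squares-mod-32 : ∀ {n} (f : Fin n → ℤ) → (∀ i → + 4 ∣ₛ f i) →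
  + 32 ∣ₛ ∑[ i < n ] (f i * f i) - + 16 * + countFin (λ i → f i ≡? + 4 [mod + 8 ])
sum-of-squares-mod-32 {n} f 4∣f =
  subst (+ 32 ∣ₛ_) sum-of-differences (∑-multiple (λ i → square-of-multiple-of-4 (4∣f i)))
  where
  δ : Fin n → ℤ
  δ i = indicator (f i ≡? + 4 [mod + 8 ])
  as-combination : ∀ x y → x - + 16 * y ≡ + 1 * x + (- + 16) * y
  as-combination = solve-∀
  sum-of-differences : ∑[ i < n ] (f i * f i - + 16 * δ i) ≡ ∑[ i < n ] (f i * f i) - + 16 * + countFin (λ i → f i ≡? + 4 [mod + 8 ])
  sum-of-differences = begin
    ∑[ i < n ] (f i * f i - + 16 * δ i)                     ≡⟨ sum-cong-≗ (λ i → as-combination (f i * f i) (δ i)) ⟩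
    ∑[ i < n ] (+ 1 * (f i * f i) + (- + 16) * δ i)         ≡⟨ ∑-linear (+ 1) (- + 16) (λ i → f i * f i) δ ⟩
    + 1 * ∑[ i < n ] (f i * f i) + (- + 16) * sum δ         ≡⟨ sym (as-combination (∑[ i < n ] (f i * f i)) (sum δ)) ⟩
    ∑[ i < n ] (f i * f i) - + 16 * sum δ                   ≡⟨ cong (λ t → ∑[ i < n ] (f i * f i) - + 16 * t) (countFin≡∑ (λ i → f i ≡? + 4 [mod + 8 ])) ⟨
    ∑[ i < n ] (f i * f i) - + 16 * + countFin (λ i → f i ≡? + 4 [mod + 8 ]) ∎

-- If n² ≡ 16c (mod 32) and n ≡ 4r (mod 8) then c ≡ r² (mod 2):
-- indeed n² ≡ (4r)² (mod 32), so 32 ∣ 16(r² − c).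
count-parity : ∀ n r c → + 32 ∣ₛ n * n - + 16 * c → + 8 ∣ₛ n - + 4 * r → + 2 ∣ₛ r * r - c
count-parity n r c n²≡16c n≡4r = *-cancelˡ-∣ (+ 16)
  (subst (+ 32 ∣ₛ_) (difference n r c)
    (∣m∣n⇒∣m-n n²≡16c (squares-mod-32 {n} {+ 4 * r} n≡4r (∣m⇒∣m*n r (divides (+ 2) refl)))))
  where
  difference : ∀ n r c → n * n - + 16 * c - (n * n - + 4 * r * (+ 4 * r)) ≡ + 16 * (r * r - c)
  difference = solve-∀

proposition2p22 : (N : ℕ) → N ≥ 4 → (H : Matrix N) → IsHadamard H →
    (((i : Fin N) → (+ 2) ∣ rowSum H i)
      × ((i j : Fin N) → rowSum H i ≡ rowSum H j [mod + 4 ]))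
    × (((i : Fin N) → rowSum H i ≡ + 0 [mod + 4 ]) →
        ((N % 8 ≡ 4 → countFin (λ i → rowSum H i ≡? + 4 [mod + 8 ]) % 2 ≡ 1)
          × (N % 8 ≡ 0 → countFin (λ i → rowSum H i ≡? + 4 [mod + 8 ]) % 2 ≡ 0)))
proposition2p22 N (s≤s (s≤s (s≤s (s≤s _)))) H hadamard@(signs , _) =
  ((λ i → ∣⇒∣ᵤ (row-sum-even signs 4∣N i)) , (λ i k → ∣⇒∣ᵤ (row-sums-congruent hadamard 4∣N i k))) ,
  λ 4∣S → (λ N≡4 → sym (parity-agrees 1 count (count-parity (+ N) (+ 1) (+ count) (N²≡16·count 4∣S) (N≡remainder N≡4)))) ,
          (λ N≡0 → sym (parity-agrees 0 count (count-parity (+ N) (+ 0) (+ count) (N²≡16·count 4∣S) (N≡remainder N≡0))))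
  where
  4∣N : + 4 ∣ₛ + N
  4∣N = order-mod-4 hadamard {zero} {suc zero} {suc (suc zero)} (λ ()) (λ ()) (λ ())
  count : ℕ
  count = countFin (λ i → rowSum H i ≡? + 4 [mod + 8 ])
  N²≡16·count : ((i : Fin N) → rowSum H i ≡ + 0 [mod + 4 ]) → + 32 ∣ₛ + N * + N - + 16 * + count
  N²≡16·count 4∣S = subst (λ q → + 32 ∣ₛ q - + 16 * + count) (parseval hadamard)
    (sum-of-squares-mod-32 (rowSum H) (λ i → subst (+ 4 ∣ₛ_) (ℤ.+-identityʳ (rowSum H i)) (∣ᵤ⇒∣ (4∣S i))))
  N≡remainder : ∀ {r} → N % 8 ≡ r → + 8 ∣ₛ + N - + r
  N≡remainder N%8≡r = subst (λ r → + 8 ∣ₛ + N - + r) N%8≡r (remainder-divides (+ N) 8)
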